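{- Let $u\in\{b,d\}^+$ be a nonempty word containing $i$ copies of $b$ and $j$ copies of $d$, and write $u(n)$ for the composition $(u_1\circ\cdots\circ u_t)(n)$ where $u=u_1\cdots u_t$. Then for all $n\ge1$, $$a(u(n))=F_{i+2j}\,a(b(n))+F_{i+2j-1}\,a(n)+C(u)\,(2x(n)-1),$$ where $C(u)$ is defined recursively by $C(b)=0$, $C(d)=1$, $C(vb)=F_{i+2j-1}+C(v)$ and $C(vd)=F_{i+2j-1}-C(v)$ for nonempty $v\in\{b,d\}^+$ (here $i,j$ are the numbers of $b$'s and $d$'s in the whole word $vb$, resp. $vd$).
   Context: $\varphi=(1+\sqrt5)/2$. Fibonacci numbers: $F_0=0$, $F_1=1$, $F_n=F_{n-1}+F_{n-2}$. The sequence $(a(n))_{n\geq 0}$ is defined by $a(n)=n$ for $n\le 1$, and $a(n)=F_{j+1}-a(n-F_j)$ if $F_j<n\le F_{j+1}$ with $j\ge 2$. $b(n)=\lfloor\varphi n\rfloor$, $d(n)=\lfloor\varphi^2 n\rfloor$, and $x(n)=a(b(n))-b(a(n))$. -}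

module Defs where

open import Data.Nat using (ℕ; zero; suc; _+_; _*_; _∸_; _≤?_; _/_)
open import Data.Integer as ℤ using (ℤ)
open import Data.List using (List; []; _∷_)
open import Data.List.NonEmpty using (List⁺; _∷_; toList; reverse)
open import Relation.Nullary using (yes; no)

fib : ℕ → ℕ
fib zero = 0
fib (suc zero) = 1
fib (suc (suc n)) = fib (suc n) + fib n

isqrt : ℕ → ℕ
isqrt zero = 0
isqrt (suc k) with suc (isqrt k) * suc (isqrt k) ≤? suc k
... | yes _ = suc (isqrt k)
... | no _ = isqrt k

-- b(n) = ⌊φ n⌋ = ⌊(n + √(5n²))/2⌋ = (n + ⌊√(5n²)⌋) div 2
b : ℕ → ℕ
b n = (n + isqrt (5 * n * n)) / 2

-- d(n) = ⌊φ² n⌋ = ⌊(3n + √(5n²))/2⌋ = (3n + ⌊√(5n²)⌋) div 2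
d : ℕ → ℕ
d n = (3 * n + isqrt (5 * n * n)) / 2

findJ : ℕ → ℕ → ℕ → ℕ
findJ zero j n = j
findJ (suc f) j n with n ≤? fib (suc j)
... | yes _ = j
... | no _ = findJ f (suc j) n

jOf : ℕ → ℕ
jOf n = findJ n 2 n

-- the recursion for a with explicit fuel (fuel n suffices, since n - F_j < n)
aF : ℕ → ℕ → ℕ
aF zero n = n
aF (suc f) n with n ≤? 1
... | yes _ = n
... | no _ = fib (suc (jOf n)) ∸ aF f (n ∸ fib (jOf n))

-- a(n) = n for n ≤ 1, a(n) = F_{j+1} - a(n - F_j) for F_j < n ≤ F_{j+1}, j ≥ 2
a : ℕ → ℕ
a n = aF n n

x : ℕ → ℤ
x n = ℤ.+ a (b n) ℤ.- ℤ.+ b (a n)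

data Letter : Set where
  𝕓 𝕕 : Letter

eval : Letter → ℕ → ℕ
eval 𝕓 = b
eval 𝕕 = d

applyList : List Letter → ℕ → ℕ
applyList [] n = n
applyList (l ∷ ls) n = eval l (applyList ls n)

applyWord : List⁺ Letter → ℕ → ℕ
applyWord u = applyList (toList u)

countB : List Letter → ℕ
countB [] = 0
countB (𝕓 ∷ ls) = suc (countB ls)
countB (𝕕 ∷ ls) = countB ls

countD : List Letter → ℕ
countD [] = 0
countD (𝕓 ∷ ls) = countD ls
countD (𝕕 ∷ ls) = suc (countD ls)

weight : List Letter → ℕ
weight ls = countB ls + 2 * countD ls

-- C on the REVERSED word (head = last letter):
-- C(b) = 0, C(d) = 1, C(vb) = F_{i+2j-1} + C(v), C(vd) = F_{i+2j-1} - C(v)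
-- where i, j are counted in the whole word vb resp. vd.
Crev′ : Letter → List Letter → ℤ
Crev′ 𝕓 [] = ℤ.0ℤ
Crev′ 𝕕 [] = ℤ.1ℤ
Crev′ 𝕓 (m ∷ ms) = ℤ.+ fib (weight (𝕓 ∷ m ∷ ms) ∸ 1) ℤ.+ Crev′ m ms
Crev′ 𝕕 (m ∷ ms) = ℤ.+ fib (weight (𝕕 ∷ m ∷ ms) ∸ 1) ℤ.- Crev′ m ms

Crev : List⁺ Letter → ℤ
Crev (l ∷ ls) = Crev′ l ls

C : List⁺ Letter → ℤ
C u = Crev (reverse u)

-- Write a block element as n = F_{i+2} + m with 1 ≤ m ≤ F_{i+1}. On such n the maps b and d act by
-- translation, b n = F_{i+3} + b m and d n = F_{i+4} + d m, so a word u of weight w (the number of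
-- b's plus twice the number of d's) moves block i into block i + w by u n = F_{i+w+2} + u m.
-- The recursion of a reads a n = F_{i+3} - a m, and together with the Beatty identity
-- b k + b k' + 1 = F_{i+2} for k + k' = F_{i+1} it gives x n = 1 - x m. Hence both sides of the
-- identity change from m to n in the same way (the Fibonacci terms agree by
-- F_{w+q} = F_w F_{q+1} + F_{w-1} F_q), and block induction reduces the theorem to n = 1, where it
-- says a (u 1) = F_{w+1} - C u. That follows by induction on the last letter of u, since
-- (v b) 1 = v 1 and (v d) 1 = v 2 = v (F_2 + 1).
--
-- The translation property of b is proved by strong induction on i, writing m as b k or d k and
-- using b (b k) = b k + k - 1 and b (d k) = d k + b k. All facts about b come from
-- b n < φ n < b n + 1, expressed without reals through the quadratic form m² - m n - n², and from
-- the irrationality of φ.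
module Submission where

open import Defs

module Beatty where

  open import Data.Nat
  open import Data.Nat.Properties
  open import Data.Nat.DivMod using (m≡m%n+[m/n]*n; m%n<n; +-distrib-/-∣ˡ; m*n/n≡m)
  open import Data.Nat.Divisibility using (_∣_; divides)
  open import Data.Nat.Primality using (prime?; euclidsLemma)
  open import Data.Nat.Induction using (<-rec)
  open import Data.Nat.Tactic.RingSolver using (solve-∀; solve)
  open import Data.List using ([]; _∷_)
  open import Data.Product using (_×_; _,_; proj₁; proj₂; ∃-syntax)
  open import Data.Sum using (_⊎_; inj₁; inj₂; [_,_]′)
  open import Function using (id; _∘_)
  open import Relation.Nullary using (¬_; yes; no; contradiction)
  open import Relation.Nullary.Decidable using (from-yes; toWitness; True)
  open import Relation.Binary.PropositionalEquality

  +≡+⇒< : ∀ {x y p r} → p < r → x + r ≡ y + p → x < y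
  +≡+⇒< {x} {y} {p} {r} p<r eq =
    +-cancelʳ-< r x y (subst (_< y + r) (sym eq) (+-monoʳ-< y p<r))

  isqrt-spec : ∀ k → isqrt k * isqrt k ≤ k × k < suc (isqrt k) * suc (isqrt k)
  isqrt-spec zero = z≤n , s≤s z≤n
  isqrt-spec (suc k) with suc (isqrt k) * suc (isqrt k) ≤? suc k | isqrt-spec k
  ... | yes r≤k | (_ , k<r) = r≤k , ≤-<-trans k<r (*-mono-< (n<1+n (suc (isqrt k))) (n<1+n (suc (isqrt k))))
  ... | no r≰k | (r≤k , _) = m≤n⇒m≤1+n r≤k , ≰⇒> r≰k

  5∣²⇒5∣ : ∀ s → 5 ∣ s * s → 5 ∣ s
  5∣²⇒5∣ s h = [ id , id ]′ (euclidsLemma s s (from-yes (prime? 5)) h)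

  -- Descent: s² = 5n² forces s = 5q and then n² = 5q² with 0 < q < n.
  sq≢5*sq : ∀ n {s} → 1 ≤ n → s * s ≢ 5 * (n * n)
  sq≢5*sq = <-rec _ descent
    where
    descent : ∀ n → (∀ {q} → q < n → ∀ {s} → 1 ≤ q → s * s ≢ 5 * (q * q)) →
              ∀ {s} → 1 ≤ n → s * s ≢ 5 * (n * n)
    descent n rec {s} 1≤n s²≡5n² with 5∣²⇒5∣ s (divides (n * n) (trans s²≡5n² (*-comm 5 (n * n))))
    ... | divides q refl = rec q<n {n} 1≤q n²≡5q²
      where
      n²≡5q² : n * n ≡ 5 * (q * q)
      n²≡5q² = sym (*-cancelˡ-≡ _ _ 5 (trans (sym (square q)) s²≡5n²))
        where
        square : ∀ q → q * 5 * (q * 5) ≡ 5 * (5 * (q * q))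
        square = solve-∀
      1≤q : 1 ≤ q
      1≤q = n≢0⇒n>0 λ { refl → <⇒≢ (*-mono-≤ 1≤n 1≤n) (sym n²≡5q²) }
      q<n : q < n
      q<n = ≰⇒> λ n≤q → <-irrefl n²≡5q² (≤-<-trans (*-mono-≤ n≤q n≤q) (subst (q * q <_) (*-comm (q * q) 5)
              (m<m*n (q * q) 5 {{>-nonZero (*-mono-≤ 1≤q 1≤q)}} (s≤s (s≤s z≤n)))))

  infix 4 _<φ·_ φ·_<_

  -- φ·n is the positive root of t² = t·n + n², so these say m < φ·n and φ·n < m.
  record _<φ·_ (m n : ℕ) : Set where
    constructor mkBelow
    field square-below : m * m < m * n + n * n

  record φ·_<_ (n m : ℕ) : Set where
    constructor mkAbove
    field square-above : m * n + n * n < m * m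

  open _<φ·_ public
  open φ·_<_ public

  φ-irrational : ∀ p {q} → 1 ≤ q → p * p ≢ p * q + q * q
  φ-irrational p {q} 1≤q p²≡pq+q² with q ≤? p
  ... | no p<q = <-irrefl p²≡pq+q²
        (≤-<-trans (*-monoʳ-≤ p (<⇒≤ (≰⇒> p<q))) (m<m+n (p * q) (*-mono-≤ 1≤q 1≤q)))
  ... | yes q≤p with m≤n⇒∃[o]m+o≡n q≤p
  ...   | r , refl = sq≢5*sq q {q + 2 * r} 1≤q (+-cancelʳ-≡ (4 * ((q + r) * q)) _ _ (begin
          (q + 2 * r) * (q + 2 * r) + 4 * ((q + r) * q)  ≡⟨ solve (q ∷ r ∷ []) ⟩
          4 * ((q + r) * (q + r)) + q * q                ≡⟨ cong (λ z → 4 * z + q * q) p²≡pq+q² ⟩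
          4 * ((q + r) * q + q * q) + q * q              ≡⟨ solve (q ∷ r ∷ []) ⟩
          5 * (q * q) + 4 * ((q + r) * q)                ∎))
    where open ≡-Reasoning

  <φ·-from-√5 : ∀ {m n t} → m * 2 ≡ n + t → t * t < 5 * (n * n) → m <φ· n
  <φ·-from-√5 {m} {n} {t} 2m≡n+t t²<5n² = mkBelow (*-cancelˡ-< 4 _ _ (+≡+⇒< t²<5n² (begin
    4 * (m * m) + 5 * (n * n)              ≡⟨ solve (m ∷ n ∷ []) ⟩
    m * 2 * (m * 2) + 5 * (n * n)          ≡⟨ cong (λ z → z * z + 5 * (n * n)) 2m≡n+t ⟩
    (n + t) * (n + t) + 5 * (n * n)        ≡⟨ solve (n ∷ t ∷ []) ⟩
    2 * n * (n + t) + 4 * (n * n) + t * t  ≡⟨ cong (λ z → 2 * n * z + 4 * (n * n) + t * t) (sym 2m≡n+t) ⟩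
    2 * n * (m * 2) + 4 * (n * n) + t * t  ≡⟨ solve (m ∷ n ∷ t ∷ []) ⟩
    4 * (m * n + n * n) + t * t            ∎)))
    where open ≡-Reasoning

  φ·<-from-√5 : ∀ {m n u} → m * 2 ≡ n + u → 5 * (n * n) < u * u → φ· n < m
  φ·<-from-√5 {m} {n} {u} 2m≡n+u 5n²<u² = mkAbove (*-cancelˡ-< 4 _ _ (+≡+⇒< 5n²<u² (begin
    4 * (m * n + n * n) + u * u            ≡⟨ solve (m ∷ n ∷ u ∷ []) ⟩
    2 * n * (m * 2) + 4 * (n * n) + u * u  ≡⟨ cong (λ z → 2 * n * z + 4 * (n * n) + u * u) 2m≡n+u ⟩
    2 * n * (n + u) + 4 * (n * n) + u * u  ≡⟨ solve (n ∷ u ∷ []) ⟩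
    (n + u) * (n + u) + 5 * (n * n)        ≡⟨ cong (λ z → z * z + 5 * (n * n)) (sym 2m≡n+u) ⟩
    m * 2 * (m * 2) + 5 * (n * n)          ≡⟨ solve (m ∷ n ∷ []) ⟩
    4 * (m * m) + 5 * (n * n)              ∎)))
    where open ≡-Reasoning

  double-suc : ∀ {n s q} → n + s ≡ q * 2 → suc q * 2 ≡ n + suc (suc s)
  double-suc {n} {s} {q} n+s≡2q = begin
    suc (suc (q * 2))  ≡⟨ cong (λ z → suc (suc z)) (sym n+s≡2q) ⟩
    suc (suc (n + s))  ≡⟨ solve (n ∷ s ∷ []) ⟩
    n + suc (suc s)    ∎
    where open ≡-Reasoning

  -- b n = ⌊(n + s)/2⌋ with s = ⌊√5·n⌋ = isqrt (5n²); r is the parity of n + s.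
  half-sum-brackets-φ· : ∀ {n s q} r → r < 2 → n + s ≡ r + q * 2 →
                     s * s < 5 * (n * n) → 5 * (n * n) < suc s * suc s → q <φ· n × φ· n < suc q
  half-sum-brackets-φ· {n} {s} {q} zero _ n+s≡2q s²<5n² 5n²<[s+1]² =
    <φ·-from-√5 (sym n+s≡2q) s²<5n² ,
    φ·<-from-√5 (double-suc {q = q} n+s≡2q) (<-≤-trans 5n²<[s+1]² (*-mono-≤ (n≤1+n (suc s)) (n≤1+n (suc s))))
  half-sum-brackets-φ· {n} {zero} {q} (suc zero) _ n≡1+2q _ 5n²<1 =
    contradiction 5n²<1 (subst (λ k → ¬ 5 * (k * k) < 1) (sym (trans (sym (+-identityʳ n)) n≡1+2q)) λ { (s≤s ()) })
  half-sum-brackets-φ· {n} {suc s} {q} (suc zero) _ n+s+1≡1+2q s²<5n² 5n²<[s+2]² =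
    <φ·-from-√5 (sym n+s≡2q) (≤-<-trans (*-mono-≤ (n≤1+n s) (n≤1+n s)) s²<5n²) ,
    φ·<-from-√5 (double-suc {q = q} n+s≡2q) 5n²<[s+2]²
    where
    n+s≡2q : n + s ≡ q * 2
    n+s≡2q = suc-injective (trans (sym (+-suc n s)) n+s+1≡1+2q)
  half-sum-brackets-φ· (suc (suc _)) (s≤s (s≤s ())) _ _ _

  b-spec : ∀ {n} → 1 ≤ n → b n <φ· n × φ· n < suc (b n)
  b-spec {n} 1≤n = half-sum-brackets-φ· ((n + s) % 2) (m%n<n (n + s) 2) (m≡m%n+[m/n]*n (n + s) 2) s²<5n² 5n²<[s+1]²
    where
    s = isqrt (5 * n * n)
    s²<5n² : s * s < 5 * (n * n)
    s²<5n² = ≤∧≢⇒< (subst (s * s ≤_) (*-assoc 5 n n) (proj₁ (isqrt-spec (5 * n * n)))) (sq≢5*sq n {s} 1≤n)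
    5n²<[s+1]² : 5 * (n * n) < suc s * suc s
    5n²<[s+1]² = subst (_< suc s * suc s) (*-assoc 5 n n) (proj₂ (isqrt-spec (5 * n * n)))

  d≡n+b : ∀ n → d n ≡ n + b n
  d≡n+b n = begin
    (3 * n + s) / 2          ≡⟨ cong (_/ 2) (regroup n s) ⟩
    (n * 2 + (n + s)) / 2    ≡⟨ +-distrib-/-∣ˡ (n + s) (divides n refl) ⟩
    n * 2 / 2 + (n + s) / 2  ≡⟨ cong (_+ b n) (m*n/n≡m n 2) ⟩
    n + b n                  ∎
    where
    open ≡-Reasoning
    s = isqrt (5 * n * n)
    regroup : ∀ n s → 3 * n + s ≡ n * 2 + (n + s)
    regroup = solve-∀

  φ·<⇒≤ : ∀ {n p} → φ· n < p → n ≤ p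
  φ·<⇒≤ {n} {p} (mkAbove pn+n²<p²) = ≮⇒≥ λ p<n →
    <⇒≱ pn+n²<p² (≤-trans (*-monoʳ-≤ p (<⇒≤ p<n)) (m≤m+n (p * n) (n * n)))

  φ·<-suc : ∀ {n p} → φ· n < p → φ· n < suc p
  φ·<-suc {n} {p} above = mkAbove (+≡+⇒<
    (+-mono-<-≤ (square-above above) (m≤n⇒m≤1+n (≤-trans (φ·<⇒≤ above) (m≤m+n p p))))
    (expand n p))
    where
    expand : ∀ n p → suc p * n + n * n + (p * p + suc (p + p)) ≡ suc p * suc p + (p * n + n * n + n)
    expand = solve-∀

  φ·<-mono : ∀ {n p q} → φ· n < p → p ≤ q → φ· n < q
  φ·<-mono {n} above p≤q = go (≤⇒≤′ p≤q)
    where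
    go : ∀ {q} → _ ≤′ q → φ· n < q
    go ≤′-refl = above
    go (≤′-step p≤′q) = φ·<-suc (go p≤′q)

  <φ·-mono : ∀ {m n n'} → m <φ· n → n ≤ n' → m <φ· n'
  <φ·-mono {m} (mkBelow m²<mn+n²) n≤n' =
    mkBelow (<-≤-trans m²<mn+n² (+-mono-≤ (*-monoʳ-≤ m n≤n') (*-mono-≤ n≤n' n≤n')))

  <φ·⇒≤b : ∀ {n m} → 1 ≤ n → m <φ· n → m ≤ b n
  <φ·⇒≤b 1≤n (mkBelow below) = ≮⇒≥ λ bn<m →
    <-asym below (square-above (φ·<-mono (proj₂ (b-spec 1≤n)) bn<m))

  φ·<⇒b< : ∀ {n m} → 1 ≤ n → φ· n < m → b n < m
  φ·<⇒b< 1≤n above = ≰⇒> λ m≤bn →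
    <-asym (square-below (proj₁ (b-spec 1≤n))) (square-above (φ·<-mono above m≤bn))

  b-unique : ∀ {n m} → 1 ≤ n → m <φ· n → φ· n < suc m → b n ≡ m
  b-unique 1≤n below above = ≤-antisym (≤-pred (φ·<⇒b< 1≤n above)) (<φ·⇒≤b 1≤n below)

  b-mono : ∀ {k k'} → 1 ≤ k → k ≤ k' → b k ≤ b k'
  b-mono 1≤k k≤k' = <φ·⇒≤b (≤-trans 1≤k k≤k') (<φ·-mono (proj₁ (b-spec 1≤k)) k≤k')

  n≤b : ∀ n → n ≤ b n
  n≤b zero = z≤n
  n≤b n@(suc _) = <φ·⇒≤b 1≤n (mkBelow (m<m+n (n * n) (*-mono-≤ 1≤n 1≤n)))
    where
    1≤n : 1 ≤ n
    1≤n = s≤s z≤n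

  b<2* : ∀ {n} → 1 ≤ n → b n < 2 * n
  b<2* {n} 1≤n = φ·<⇒b< 1≤n (mkAbove (+≡+⇒< (*-mono-≤ 1≤n 1≤n) (expand n)))
    where
    expand : ∀ n → 2 * n * n + n * n + n * n ≡ 2 * n * (2 * n) + 0
    expand = solve-∀

  -- Closed instances of b must never be normalised (isqrt takes exponential time when evaluated
  -- by the type checker); this decides b n = m from the two defining inequalities instead.
  b-by-squares : ∀ {n m} → 1 ≤ n → True (m * m <? m * n + n * n) → True (suc m * n + n * n <? suc m * suc m) →
                 b n ≡ m
  b-by-squares 1≤n below above = b-unique 1≤n (mkBelow (toWitness below)) (mkAbove (toWitness above))

  <φ·⊎φ·< : ∀ m {n} → 1 ≤ n → m <φ· n ⊎ φ· n < m
  <φ·⊎φ·< m {n} 1≤n with m * m <? m * n + n * n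
  ... | yes below = inj₁ (mkBelow below)
  ... | no ¬below = inj₂ (mkAbove (≤∧≢⇒< (≮⇒≥ ¬below) (≢-sym (φ-irrational m 1≤n))))

  -- Both directions of  m < φ·n ⇔ φ·m < m + n,  that is, of φ - 1 = 1/φ.
  φ·<+⇒<φ· : ∀ {m n} → φ· m < m + n → m <φ· n
  φ·<+⇒<φ· {m} {n} (mkAbove above) = mkBelow (+≡+⇒< above (expand m n))
    where
    expand : ∀ m n → m * m + (m + n) * (m + n) ≡ m * n + n * n + ((m + n) * m + m * m)
    expand = solve-∀

  +<φ·⇒φ·< : ∀ {m n} → m + n <φ· m → φ· n < m
  +<φ·⇒φ·< {m} {n} (mkBelow below) = mkAbove (+≡+⇒< below (expand m n))
    where
    expand : ∀ m n → m * n + n * n + ((m + n) * m + m * m) ≡ m * m + (m + n) * (m + n)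
    expand = solve-∀

  b∘b : ∀ {n} → 1 ≤ n → b (b n) + 1 ≡ b n + n
  b∘b {n@(suc k)} 1≤n = begin
    b B + 1      ≡⟨ cong (_+ 1) (b-unique 1≤B below above) ⟩
    B + k + 1    ≡⟨ +-assoc B k 1 ⟩
    B + (k + 1)  ≡⟨ cong (B +_) (+-comm k 1) ⟩
    B + n        ∎
    where
    open ≡-Reasoning
    B = b n
    expand₀ : ∀ k → 2 * suc k + k ≡ suc (3 * k + 1)
    expand₀ = solve-∀
    expand₁ : ∀ B k → (B + k) * (B + k) + (suc B * suc B + (3 * k + 1))
                      ≡ (B + k) * B + B * B + (suc B * suc k + suc k * suc k + B)
    expand₁ = solve-∀
    expand₂ : ∀ B k → suc (B + k) * B + B * B + (B * suc k + suc k * suc k) ≡ suc (B + k) * suc (B + k) + B * B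
    expand₂ = solve-∀
    1≤B : 1 ≤ B
    1≤B = ≤-trans 1≤n (n≤b n)
    B≤3k+1 : B ≤ 3 * k + 1
    B≤3k+1 = ≤-pred (≤-trans (b<2* 1≤n) (≤-trans (m≤m+n (2 * n) k) (≤-reflexive (expand₀ k))))
    below : B + k <φ· B
    below = mkBelow (+≡+⇒< (+-mono-<-≤ (square-above (proj₂ (b-spec 1≤n))) B≤3k+1) (expand₁ B k))
    above : φ· B < suc (B + k)
    above = mkAbove (+≡+⇒< (square-below (proj₁ (b-spec 1≤n))) (expand₂ B k))

  b∘d : ∀ {k} → 1 ≤ k → b (d k) ≡ d k + b k
  b∘d {k} 1≤k rewrite d≡n+b k = b-unique (≤-trans 1≤k (m≤m+n k B)) below above
    where
    B = b k
    expand₁ : ∀ k B → (k + B + B) * (k + B + B) + (B * k + k * k) ≡ (k + B + B) * (k + B) + (k + B) * (k + B) + B * B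
    expand₁ = solve-∀
    expand₂ : ∀ k B → suc (k + B + B) * (k + B) + (k + B) * (k + B) + (suc B * suc B + (B + 2 * k))
                      ≡ suc (k + B + B) * suc (k + B + B) + (suc B * k + k * k)
    expand₂ = solve-∀
    below : k + B + B <φ· k + B
    below = mkBelow (+≡+⇒< (square-below (proj₁ (b-spec 1≤k))) (expand₁ k B))
    above : φ· k + B < suc (k + B + B)
    above = mkAbove (+≡+⇒< (<-≤-trans (square-above (proj₂ (b-spec 1≤k))) (m≤m+n _ (B + 2 * k))) (expand₂ k B))

  -- With b m = m + t, either φ·(t + 1) < m + 1 and m = b (t + 1), or m = d (m - t).
  b-or-d : ∀ {m} → 1 ≤ m → (∃[ k ] 1 ≤ k × b k ≡ m) ⊎ (∃[ k ] 1 ≤ k × d k ≡ m)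
  b-or-d {m} 1≤m = [ inj₂ ∘ d-preimage , inj₁ ∘ b-preimage ]′ (<φ·⊎φ·< (suc m) {suc t} (s≤s z≤n))
    where
    t = b m ∸ m
    m+t≡bm : m + t ≡ b m
    m+t≡bm = m+[n∸m]≡n (n≤b m)
    t<m : t < m
    t<m = +-cancelˡ-< m t m (subst₂ _<_ (sym m+t≡bm) (cong (m +_) (+-identityʳ m)) (b<2* 1≤m))
    s = m ∸ t
    t+s≡m : t + s ≡ m
    t+s≡m = m+[n∸m]≡n (<⇒≤ t<m)
    1≤s : 1 ≤ s
    1≤s = m<n⇒0<n∸m t<m
    b-preimage : φ· suc t < suc m → ∃[ k ] 1 ≤ k × b k ≡ m
    b-preimage above = suc t , s≤s z≤n , b-unique (s≤s z≤n) (φ·<+⇒<φ· bm-above) above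
      where
      bm-above : φ· m < m + suc t
      bm-above = subst (φ· m <_) (trans (cong suc (sym m+t≡bm)) (sym (+-suc m t))) (proj₂ (b-spec 1≤m))
    d-preimage : suc m <φ· suc t → ∃[ k ] 1 ≤ k × d k ≡ m
    d-preimage below = s , 1≤s , (begin
      d s      ≡⟨ d≡n+b s ⟩
      s + b s  ≡⟨ cong (s +_) bs≡t ⟩
      s + t    ≡⟨ +-comm s t ⟩
      t + s    ≡⟨ t+s≡m ⟩
      m        ∎)
      where
      open ≡-Reasoning
      bm-below : (t + s) + t <φ· t + s
      bm-below = subst (λ n → n + t <φ· n) (sym t+s≡m) (subst (_<φ· m) (sym m+t≡bm) (proj₁ (b-spec 1≤m)))
      below' : suc t + s <φ· suc t
      below' = subst (λ n → suc n <φ· suc t) (sym t+s≡m) below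
      bs≡t : b s ≡ t
      bs≡t = b-unique 1≤s (φ·<+⇒<φ· (+<φ·⇒φ·< bm-below)) (+<φ·⇒φ·< below')

module Blocks where

  open Beatty
  open import Algebra.Properties.CommutativeSemigroup using (interchange)
  open import Data.Nat
  open import Data.Nat.Properties
  open import Data.Nat.Induction using (<-rec)
  open import Data.Nat.Tactic.RingSolver using (solve-∀)
  open import Data.Product using (_×_; _,_; ∃₂; ∃-syntax)
  open import Data.Sum using (inj₁; inj₂; [_,_]′)
  open import Function using (_∘_)
  open import Relation.Binary.PropositionalEquality
  open import Relation.Binary.Definitions using (tri<; tri≈; tri>)
  open import Relation.Nullary using (contradiction)

  +-interchange : ∀ w x y z → (w + x) + (y + z) ≡ (w + y) + (x + z)
  +-interchange = interchange +-commutativeSemigroup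

  fib-pos : ∀ i → 1 ≤ fib (suc i)
  fib-pos zero = s≤s z≤n
  fib-pos (suc i) = ≤-trans (fib-pos i) (m≤m+n _ _)

  fib-mono : ∀ {i j} → i ≤ j → fib i ≤ fib j
  fib-mono {i} i≤j = go (≤⇒≤′ i≤j)
    where
    fib≤fib-suc : ∀ j → fib j ≤ fib (suc j)
    fib≤fib-suc zero = z≤n
    fib≤fib-suc (suc j) = m≤m+n _ _
    go : ∀ {j} → i ≤′ j → fib i ≤ fib j
    go ≤′-refl = ≤-refl
    go (≤′-step {j} i≤′j) = ≤-trans (go i≤′j) (fib≤fib-suc j)

  fib-+ : ∀ p q → fib (suc p + q) ≡ fib (suc p) * fib (suc q) + fib p * fib q
  fib-+ zero q = sym (trans (+-identityʳ _) (+-identityʳ _))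
  fib-+ (suc p) q = begin
    fib (suc (suc p + q))                                   ≡⟨ cong fib (sym (+-suc (suc p) q)) ⟩
    fib (suc p + suc q)                                     ≡⟨ fib-+ p (suc q) ⟩
    fib (suc p) * fib (suc (suc q)) + fib p * fib (suc q)   ≡⟨ regroup (fib (suc p)) (fib p) (fib (suc q)) (fib q) ⟩
    fib (suc (suc p)) * fib (suc q) + fib (suc p) * fib q   ∎
    where
    open ≡-Reasoning
    regroup : ∀ x y u v → x * (u + v) + y * u ≡ (x + y) * u + x * v
    regroup = solve-∀

  -- Block i is the interval F_{i+2} < n ≤ F_{i+3}; block i m is its m-th element, for 1 ≤ m ≤ F_{i+1}.
  block : ℕ → ℕ → ℕ
  block i m = fib (2 + i) + m

  block-decomposition : ∀ n → 2 ≤ n → ∃₂ λ i m → 1 ≤ m × m ≤ fib (1 + i) × n ≡ block i m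
  block-decomposition (suc zero) (s≤s ())
  block-decomposition (suc (suc zero)) _ = 0 , 1 , s≤s z≤n , s≤s z≤n , refl
  block-decomposition (suc (suc (suc n))) _ with block-decomposition (suc (suc n)) (s≤s (s≤s z≤n))
  ... | i , m , 1≤m , m≤F , n≡F+m with m≤n⇒m<n∨m≡n m≤F
  ...   | inj₁ m<F = i , suc m , s≤s z≤n , m<F , trans (cong suc n≡F+m) (sym (+-suc _ m))
  ...   | inj₂ refl = suc i , 1 , s≤s z≤n , fib-pos (suc i) , trans (cong suc n≡F+m) (+-comm 1 _)

  block-ind : ∀ (P : ℕ → Set) → P 1 →
              (∀ {i m} → 1 ≤ m → m ≤ fib (1 + i) → P m → P (block i m)) →
              ∀ {n} → 1 ≤ n → P n
  block-ind P base step {n} = <-rec (λ n → 1 ≤ n → P n) go n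
    where
    go : ∀ n → (∀ {k} → k < n → 1 ≤ k → P k) → 1 ≤ n → P n
    go (suc zero) _ _ = base
    go n@(suc (suc _)) rec _ with block-decomposition n (s≤s (s≤s z≤n))
    ... | i , m , 1≤m , m≤F , n≡F+m =
      subst P (sym n≡F+m) (step {i} 1≤m m≤F (rec (subst (m <_) (sym n≡F+m) (m<n+m m (fib-pos (suc i)))) 1≤m))

  ShiftsAt : ℕ → (ℕ → ℕ) → ℕ → Set
  ShiftsAt s f i = ∀ {m} → 1 ≤ m → m ≤ fib (1 + i) → f (block i m) ≡ block (s + i) (f m)

  d-shift : ∀ {i} → ShiftsAt 1 b i → ShiftsAt 2 d i
  d-shift {i} b-sh {m} 1≤m m≤F = begin
    d (fib (2 + i) + m)                        ≡⟨ d≡n+b (fib (2 + i) + m) ⟩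
    fib (2 + i) + m + b (fib (2 + i) + m)      ≡⟨ cong (fib (2 + i) + m +_) (b-sh 1≤m m≤F) ⟩
    fib (2 + i) + m + (fib (3 + i) + b m)      ≡⟨ +-interchange (fib (2 + i)) m (fib (3 + i)) (b m) ⟩
    fib (2 + i) + fib (3 + i) + (m + b m)      ≡⟨ cong₂ _+_ (+-comm (fib (2 + i)) _) (sym (d≡n+b m)) ⟩
    fib (4 + i) + d m                          ∎
    where open ≡-Reasoning

  b-above-block : ∀ {i k} → ShiftsAt 1 b i → fib (2 + i) < k → fib (3 + i) < b k
  b-above-block {i} {k} b-sh F<k = <-≤-trans (m<m+n (fib (3 + i)) (s≤s z≤n))
    (subst (_≤ b k) (b-sh (s≤s z≤n) (fib-pos i)) (b-mono (m≤n+m 1 _) (subst (_≤ k) (+-comm 1 _) F<k)))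

  b-shift-at-b : ∀ {j m} → ShiftsAt 1 b j → ShiftsAt 1 b (1 + j) → m ≤ fib (3 + j) →
                 ∃[ k ] 1 ≤ k × b k ≡ m → b (fib (4 + j) + m) ≡ fib (5 + j) + b m
  b-shift-at-b {j} b-sh₀ b-sh₁ bk≤F (k , 1≤k , refl) = +-cancelʳ-≡ 1 _ _ (begin
    b (fib (4 + j) + b k) + 1              ≡⟨ cong (λ z → b z + 1) (sym bN) ⟩
    b (b N) + 1                            ≡⟨ b∘b {N} (≤-trans 1≤k (m≤n+m k _)) ⟩
    b N + N                                ≡⟨ cong (_+ N) bN ⟩
    fib (4 + j) + b k + (fib (3 + j) + k)  ≡⟨ +-interchange (fib (4 + j)) (b k) (fib (3 + j)) k ⟩
    fib (5 + j) + (b k + k)                ≡⟨ cong (fib (5 + j) +_) (sym (b∘b {k} 1≤k)) ⟩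
    fib (5 + j) + (b (b k) + 1)            ≡⟨ sym (+-assoc (fib (5 + j)) _ 1) ⟩
    fib (5 + j) + b (b k) + 1              ∎)
    where
    open ≡-Reasoning
    N = fib (3 + j) + k
    bN : b N ≡ fib (4 + j) + b k
    bN = b-sh₁ 1≤k (≮⇒≥ λ F<k → <⇒≱ (b-above-block {j} b-sh₀ F<k) bk≤F)

  b-shift-at-d : ∀ {j m} → ShiftsAt 1 b j → (∀ {k} → fib (1 + j) < k → fib (2 + j) < b k) →
                 m ≤ fib (3 + j) → ∃[ k ] 1 ≤ k × d k ≡ m → b (fib (4 + j) + m) ≡ fib (5 + j) + b m
  b-shift-at-d {j} b-sh b-above dk≤F (k , 1≤k , refl) = begin
    b (fib (4 + j) + d k)                  ≡⟨ cong b (sym dN) ⟩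
    b (d N)                                ≡⟨ b∘d {N} (≤-trans 1≤k (m≤n+m k _)) ⟩
    d N + b N                              ≡⟨ cong₂ _+_ dN bN ⟩
    fib (4 + j) + d k + (fib (3 + j) + b k)  ≡⟨ +-interchange (fib (4 + j)) (d k) (fib (3 + j)) (b k) ⟩
    fib (5 + j) + (d k + b k)              ≡⟨ cong (fib (5 + j) +_) (sym (b∘d {k} 1≤k)) ⟩
    fib (5 + j) + b (d k)                  ∎
    where
    open ≡-Reasoning
    N = fib (2 + j) + k
    k≤F : k ≤ fib (1 + j)
    k≤F = ≮⇒≥ λ F<k → <⇒≱ (subst (fib (3 + j) <_) (trans (+-comm (b k) k) (sym (d≡n+b k)))
                                     (+-mono-< (b-above F<k) F<k)) dk≤F
    bN : b N ≡ fib (3 + j) + b k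
    bN = b-sh 1≤k k≤F
    dN : d N ≡ fib (4 + j) + d k
    dN = d-shift {j} b-sh 1≤k k≤F

  b-above-block′ : ∀ j → (∀ {i} → i < j → ShiftsAt 1 b i) → ∀ {k} → fib (1 + j) < k → fib (2 + j) < b k
  b-above-block′ zero _ {k} 1<k = ≤-trans 1<k (n≤b k)
  b-above-block′ (suc j) b-sh = b-above-block {j} (b-sh (n<1+n j))

  b-shift : ∀ i → ShiftsAt 1 b i
  b-shift = <-rec (ShiftsAt 1 b) go
    where
    go : ∀ i → (∀ {j} → j < i → ShiftsAt 1 b j) → ShiftsAt 1 b i
    go zero _ 1≤m m≤1 =
      subst (λ m → b (fib 2 + m) ≡ fib 3 + b m) (≤-antisym 1≤m m≤1) (b-by-squares {fib 2 + 1} (s≤s z≤n) _ _)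
    go (suc zero) _ 1≤m m≤1 =
      subst (λ m → b (fib 3 + m) ≡ fib 4 + b m) (≤-antisym 1≤m m≤1) (b-by-squares {fib 3 + 1} (s≤s z≤n) _ _)
    -- [_,_]′ instead of a with-abstraction, which would normalise the goal b (block (2 + j) m) at great cost.
    go (suc (suc j)) rec 1≤m m≤F =
      [ b-shift-at-b {j} (rec {j} j<2+j) (rec (n<1+n (suc j))) m≤F
      , b-shift-at-d {j} (rec {j} j<2+j) (b-above-block′ j (rec ∘ (λ i<j → <-trans i<j j<2+j))) m≤F
      ]′ (b-or-d 1≤m)
      where
      j<2+j : j < 2 + j
      j<2+j = m<n+m j (s≤s z≤n)

  b-fib-bound : ∀ i → b (fib (1 + i)) ≤ fib (2 + i)
  b-fib-bound zero = s≤s z≤n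
  b-fib-bound (suc zero) = s≤s z≤n
  b-fib-bound (suc (suc i)) =
    subst (_≤ fib (4 + i)) (sym (b-shift i (fib-pos i) ≤-refl)) (+-monoʳ-≤ (fib (3 + i)) (b-fib-bound i))

  b-block-bound : ∀ {i m} → 1 ≤ m → m ≤ fib (1 + i) → b m ≤ fib (2 + i)
  b-block-bound {i} 1≤m m≤F = ≤-trans (b-mono 1≤m m≤F) (b-fib-bound i)

  BSumAt : ℕ → Set
  BSumAt i = ∀ {k k'} → 1 ≤ k → 1 ≤ k' → k + k' ≡ fib (1 + i) → b k + b k' + 1 ≡ fib (2 + i)

  b-sum-upper : ∀ {i k k'} → BSumAt (1 + i) → 1 ≤ k' → fib (3 + i) < k → k + k' ≡ fib (4 + i) →
                b k + b k' + 1 ≡ fib (5 + i)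
  b-sum-upper {i} {k} {k'} b-sum 1≤k' F<k k+k'≡F = begin
    b k + b k' + 1                   ≡⟨ cong (λ z → b z + b k' + 1) (sym F+o≡k) ⟩
    b (fib (3 + i) + o) + b k' + 1   ≡⟨ cong (λ z → z + b k' + 1) (b-shift (1 + i) 1≤o o≤F) ⟩
    fib (4 + i) + b o + b k' + 1     ≡⟨ cong (_+ 1) (+-assoc (fib (4 + i)) (b o) (b k')) ⟩
    fib (4 + i) + (b o + b k') + 1   ≡⟨ +-assoc (fib (4 + i)) _ 1 ⟩
    fib (4 + i) + (b o + b k' + 1)   ≡⟨ cong (fib (4 + i) +_) (b-sum 1≤o 1≤k' o+k'≡F) ⟩
    fib (5 + i)                      ∎
    where
    open ≡-Reasoning
    o = k ∸ fib (3 + i)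
    F+o≡k : fib (3 + i) + o ≡ k
    F+o≡k = m+[n∸m]≡n (<⇒≤ F<k)
    1≤o : 1 ≤ o
    1≤o = m<n⇒0<n∸m F<k
    o+k'≡F : o + k' ≡ fib (2 + i)
    o+k'≡F = +-cancelˡ-≡ (fib (3 + i)) _ _
               (trans (sym (+-assoc (fib (3 + i)) o k')) (trans (cong (_+ k') F+o≡k) k+k'≡F))
    o≤F : o ≤ fib (2 + i)
    o≤F = subst (o ≤_) o+k'≡F (m≤m+n o k')

  b-sum-fib : ∀ i → BSumAt (2 + i) → b (fib (3 + i)) + b (fib (2 + i)) + 1 ≡ fib (5 + i)
  b-sum-fib i b-sum = begin
    b (fib (3 + i)) + b (fib (2 + i)) + 1
      ≡⟨ cong (λ x → x + b (fib (2 + i)) + 1) (b-shift i (fib-pos i) ≤-refl) ⟩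
    fib (3 + i) + b (fib (1 + i)) + b (fib (2 + i)) + 1
      ≡⟨ trans (cong (_+ 1) (+-assoc (fib (3 + i)) _ _)) (+-assoc (fib (3 + i)) _ 1) ⟩
    fib (3 + i) + (b (fib (1 + i)) + b (fib (2 + i)) + 1)
      ≡⟨ cong (fib (3 + i) +_) (b-sum (fib-pos i) (fib-pos (1 + i)) (+-comm (fib (1 + i)) _)) ⟩
    fib (3 + i) + fib (4 + i)
      ≡⟨ +-comm (fib (3 + i)) _ ⟩
    fib (5 + i) ∎
    where open ≡-Reasoning

  b-sum-middle : ∀ {i k k'} → BSumAt i → fib (2 + i) < k → fib (2 + i) < k' → k + k' ≡ fib (4 + i) →
                 b k + b k' + 1 ≡ fib (5 + i)
  b-sum-middle {i} {k} {k'} b-sum F<k F<k' k+k'≡F = begin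
    b k + b k' + 1
      ≡⟨ cong₂ (λ x y → b x + b y + 1) (sym F+o≡k) (sym F+o'≡k') ⟩
    b (block i o) + b (block i o') + 1
      ≡⟨ cong₂ (λ x y → x + y + 1) (b-shift i 1≤o o≤F) (b-shift i 1≤o' o'≤F) ⟩
    fib (3 + i) + b o + (fib (3 + i) + b o') + 1
      ≡⟨ cong (_+ 1) (+-interchange (fib (3 + i)) (b o) (fib (3 + i)) (b o')) ⟩
    fib (3 + i) + fib (3 + i) + (b o + b o') + 1
      ≡⟨ +-assoc (fib (3 + i) + fib (3 + i)) _ 1 ⟩
    fib (3 + i) + fib (3 + i) + (b o + b o' + 1)
      ≡⟨ cong (fib (3 + i) + fib (3 + i) +_) (b-sum 1≤o 1≤o' o+o'≡F) ⟩
    fib (3 + i) + fib (3 + i) + fib (2 + i)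
      ≡⟨ trans (+-assoc (fib (3 + i)) _ _) (+-comm (fib (3 + i)) _) ⟩
    fib (5 + i) ∎
    where
    open ≡-Reasoning
    o = k ∸ fib (2 + i)
    o' = k' ∸ fib (2 + i)
    F+o≡k : fib (2 + i) + o ≡ k
    F+o≡k = m+[n∸m]≡n (<⇒≤ F<k)
    F+o'≡k' : fib (2 + i) + o' ≡ k'
    F+o'≡k' = m+[n∸m]≡n (<⇒≤ F<k')
    1≤o : 1 ≤ o
    1≤o = m<n⇒0<n∸m F<k
    1≤o' : 1 ≤ o'
    1≤o' = m<n⇒0<n∸m F<k'
    o+o'≡F : o + o' ≡ fib (1 + i)
    o+o'≡F = +-cancelˡ-≡ (fib (2 + i) + fib (2 + i)) _ _ (begin
      fib (2 + i) + fib (2 + i) + (o + o')     ≡⟨ +-interchange (fib (2 + i)) _ o _ ⟩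
      (fib (2 + i) + o) + (fib (2 + i) + o')   ≡⟨ cong₂ _+_ F+o≡k F+o'≡k' ⟩
      k + k'                                   ≡⟨ k+k'≡F ⟩
      fib (3 + i) + fib (2 + i)                ≡⟨ +-comm (fib (3 + i)) _ ⟩
      fib (2 + i) + fib (3 + i)                ≡⟨ sym (+-assoc (fib (2 + i)) _ _) ⟩
      fib (2 + i) + fib (2 + i) + fib (1 + i)  ∎)
    o≤F : o ≤ fib (1 + i)
    o≤F = subst (o ≤_) o+o'≡F (m≤m+n o o')
    o'≤F : o' ≤ fib (1 + i)
    o'≤F = subst (o' ≤_) o+o'≡F (m≤n+m o' o)

  b-sum-swap : ∀ {k k' n} → b k' + b k + 1 ≡ n → b k + b k' + 1 ≡ n
  b-sum-swap {k} {k'} = trans (cong (_+ 1) (+-comm (b k) (b k')))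

  <-complement : ∀ {k k' x y} → k + k' ≡ y + x → k' < x → y < k
  <-complement k+k'≡y+x k'<x = ≰⇒> λ k≤y → <-irrefl k+k'≡y+x (+-mono-≤-< k≤y k'<x)

  b-sum-step : ∀ {i} → BSumAt i → BSumAt (1 + i) → BSumAt (2 + i) → BSumAt (3 + i)
  b-sum-step {i} b-sum₀ b-sum₁ b-sum₂ {k} {k'} 1≤k 1≤k' k+k'≡F with <-cmp (fib (3 + i)) k | <-cmp (fib (3 + i)) k'
  ... | tri< F<k _ _ | _ = b-sum-upper {i} b-sum₁ 1≤k' F<k k+k'≡F
  ... | _ | tri< F<k' _ _ = b-sum-swap {k} {k'} (b-sum-upper {i} b-sum₁ 1≤k F<k' (trans (+-comm k' k) k+k'≡F))
  ... | tri≈ _ refl _ | _ =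
    subst (λ k' → b (fib (3 + i)) + b k' + 1 ≡ fib (5 + i)) (+-cancelˡ-≡ (fib (3 + i)) _ _ (sym k+k'≡F))
          (b-sum-fib i b-sum₂)
  ... | _ | tri≈ _ refl _ =
    b-sum-swap {k} {k'} (subst (λ k → b (fib (3 + i)) + b k + 1 ≡ fib (5 + i))
                      (+-cancelˡ-≡ (fib (3 + i)) _ _ (trans (sym k+k'≡F) (+-comm k _))) (b-sum-fib i b-sum₂))
  ... | tri> _ _ k<F | tri> _ _ k'<F = b-sum-middle {i} b-sum₀ (<-complement F≡F₂+F₃ k'<F)
                                         (<-complement (trans (+-comm k' k) F≡F₂+F₃) k<F) k+k'≡F
    where
    F≡F₂+F₃ : k + k' ≡ fib (2 + i) + fib (3 + i)
    F≡F₂+F₃ = trans k+k'≡F (+-comm (fib (3 + i)) _)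

  b-sum : ∀ i → BSumAt i
  b-sum = <-rec BSumAt go
    where
    too-small : ∀ {k k'} → 1 ≤ k → 1 ≤ k' → k + k' ≢ 1
    too-small 1≤k 1≤k' k+k'≡1 = <⇒≱ (+-mono-≤ 1≤k 1≤k') (≤-reflexive k+k'≡1)
    go : ∀ i → (∀ {j} → j < i → BSumAt j) → BSumAt i
    go zero _ 1≤k 1≤k' k+k'≡1 = contradiction k+k'≡1 (too-small 1≤k 1≤k')
    go (suc zero) _ 1≤k 1≤k' k+k'≡1 = contradiction k+k'≡1 (too-small 1≤k 1≤k')
    go (suc (suc zero)) _ {k} {k'} 1≤k 1≤k' k+k'≡2 =
      subst₂ (λ k k' → b k + b k' + 1 ≡ fib 4) (sym k≡1) (sym k'≡1) refl
      where
      k≡1 : k ≡ 1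
      k≡1 = ≤-antisym (+-cancelʳ-≤ 1 k 1 (≤-trans (+-monoʳ-≤ k 1≤k') (≤-reflexive k+k'≡2))) 1≤k
      k'≡1 : k' ≡ 1
      k'≡1 = ≤-antisym (+-cancelʳ-≤ 1 k' 1
               (≤-trans (+-monoʳ-≤ k' 1≤k) (≤-reflexive (trans (+-comm k' k) k+k'≡2)))) 1≤k'
    go (suc (suc (suc i))) rec =
      b-sum-step {i} (rec (m<n+m i {3} (s≤s z≤n))) (rec (m<n+m (1 + i) {2} (s≤s z≤n))) (rec (n<1+n (2 + i)))

module Hofstadter where

  open Blocks
  open import Data.Nat
  open import Data.Nat.Properties
  open import Data.Product using (_×_; _,_; proj₂)
  open import Relation.Nullary using (yes; no; contradiction)
  open import Relation.Binary.PropositionalEquality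

  findJ-least : ∀ {fuel j n} t → t ≤ fuel → n ≤ fib (suc (j + t)) →
                (∀ {u} → u < t → fib (suc (j + u)) < n) → findJ fuel j n ≡ j + t
  findJ-least {zero} {j} zero _ _ _ = sym (+-identityʳ j)
  findJ-least {suc fuel} {j} {n} t t≤fuel n≤F below with n ≤? fib (suc j)
  findJ-least {suc fuel} {j} {n} zero t≤fuel n≤F below | yes _ = sym (+-identityʳ j)
  findJ-least {suc fuel} {j} {n} (suc t) t≤fuel n≤F below | yes n≤F₀ =
    contradiction (subst (λ k → n ≤ fib (suc k)) (sym (+-identityʳ j)) n≤F₀) (<⇒≱ (below (s≤s z≤n)))
  findJ-least {suc fuel} {j} {n} zero t≤fuel n≤F below | no n≰F₀ =
    contradiction (subst (λ k → n ≤ fib (suc k)) (+-identityʳ j) n≤F) n≰F₀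
  findJ-least {suc fuel} {j} {n} (suc t) t≤fuel n≤F below | no _ =
    trans (findJ-least t (s≤s⁻¹ t≤fuel) (subst (λ k → n ≤ fib (suc k)) (+-suc j t) n≤F)
                       (λ {u} u<t → subst (λ k → fib (suc k) < n) (+-suc j u) (below (s≤s u<t))))
          (sym (+-suc j t))

  findJ-≥ : ∀ fuel j n → j ≤ findJ fuel j n
  findJ-≥ zero j n = ≤-refl
  findJ-≥ (suc fuel) j n with n ≤? fib (suc j)
  ... | yes _ = ≤-refl
  ... | no _ = ≤-trans (n≤1+n j) (findJ-≥ fuel (suc j) n)

  suc≤fib : ∀ i → suc i ≤ fib (2 + i)
  suc≤fib zero = s≤s z≤n
  suc≤fib (suc i) = subst (_≤ fib (3 + i)) (+-comm (suc i) 1) (+-mono-≤ (suc≤fib i) (fib-pos i))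

  jOf-block : ∀ {i m} → 1 ≤ m → m ≤ fib (1 + i) → jOf (block i m) ≡ 2 + i
  jOf-block {i} {m} 1≤m m≤F = findJ-least i
    (≤-trans (n≤1+n i) (≤-trans (suc≤fib i) (m≤m+n _ m)))
    (+-monoʳ-≤ (fib (2 + i)) m≤F)
    (λ u<i → ≤-<-trans (fib-mono (+-monoʳ-≤ 2 u<i)) (m<m+n (fib (2 + i)) 1≤m))

  fib-jOf-pos : ∀ n → 1 ≤ fib (jOf n)
  fib-jOf-pos n = fib-mono {1} (≤-trans (s≤s z≤n) (findJ-≥ n 2 n))

  aF-fuel-irrelevant : ∀ {f g n} → n ≤ f → n ≤ g → aF f n ≡ aF g n
  aF-fuel-irrelevant {zero} {zero} _ _ = refl
  aF-fuel-irrelevant {zero} {suc g} z≤n _ = refl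
  aF-fuel-irrelevant {suc f} {zero} _ z≤n = refl
  aF-fuel-irrelevant {suc f} {suc g} {n} n≤f n≤g with n ≤? 1
  ... | yes _ = refl
  ... | no _ = cong (fib (suc (jOf n)) ∸_)
                  (aF-fuel-irrelevant {f} {g} (∸-mono n≤f (fib-jOf-pos n)) (∸-mono n≤g (fib-jOf-pos n)))

  a-unfold : ∀ {n} → 2 ≤ n → a n ≡ fib (suc (jOf n)) ∸ a (n ∸ fib (jOf n))
  a-unfold {suc zero} (s≤s ())
  a-unfold {n@(suc (suc k))} _ =
    cong (fib (suc (jOf n)) ∸_)
         (aF-fuel-irrelevant {suc k} {n ∸ fib (jOf n)} (∸-mono {n} ≤-refl (fib-jOf-pos n)) ≤-refl)

  a-block : ∀ {i m} → 1 ≤ m → m ≤ fib (1 + i) → a (block i m) ≡ fib (3 + i) ∸ a m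
  a-block {i} {m} 1≤m m≤F = begin
    a n                                    ≡⟨ a-unfold (+-mono-≤ (fib-pos (suc i)) 1≤m) ⟩
    fib (suc (jOf n)) ∸ a (n ∸ fib (jOf n))  ≡⟨ cong (λ j → fib (suc j) ∸ a (n ∸ fib j)) (jOf-block {i} 1≤m m≤F) ⟩
    fib (3 + i) ∸ a (n ∸ fib (2 + i))      ≡⟨ cong (λ k → fib (3 + i) ∸ a k) (m+n∸m≡n (fib (2 + i)) m) ⟩
    fib (3 + i) ∸ a m                      ∎
    where
    open ≡-Reasoning
    n = block i m

  a-bounds : ∀ {m} → 1 ≤ m → ∀ {i} → m ≤ fib i → 1 ≤ a m × a m ≤ fib i
  a-bounds = block-ind (λ m → ∀ {i} → m ≤ fib i → 1 ≤ a m × a m ≤ fib i) (λ 1≤F → s≤s z≤n , 1≤F)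
                       (λ {j} → step {j})
    where
    step : ∀ {j m} → 1 ≤ m → m ≤ fib (1 + j) → (∀ {i} → m ≤ fib i → 1 ≤ a m × a m ≤ fib i) →
           ∀ {i} → block j m ≤ fib i → 1 ≤ a (block j m) × a (block j m) ≤ fib i
    step {j} {m} 1≤m m≤F bounds {i} n≤F =
      subst (λ k → 1 ≤ k × k ≤ fib i) (sym (a-block {j} 1≤m m≤F)) (lower , upper)
      where
      lower : 1 ≤ fib (3 + j) ∸ a m
      lower = ≤-trans (fib-pos (suc j)) (subst (_≤ fib (3 + j) ∸ a m) (m+n∸n≡m (fib (2 + j)) (fib (1 + j)))
                                         (∸-monoʳ-≤ (fib (3 + j)) (proj₂ (bounds {1 + j} m≤F))))
      3+j≤i : 3 + j ≤ i
      3+j≤i = ≮⇒≥ λ i<3+j → <⇒≱ (m<m+n (fib (2 + j)) 1≤m) (≤-trans n≤F (fib-mono (s≤s⁻¹ i<3+j)))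
      upper : fib (3 + j) ∸ a m ≤ fib i
      upper = ≤-trans (m∸n≤m _ (a m)) (fib-mono 3+j≤i)

module Words where

  open Beatty
  open Blocks
  open import Data.Nat
  open import Data.Nat.Properties
  open import Data.Nat.Tactic.RingSolver using (solve-∀)
  open import Data.List as List using ([]; _∷_; _++_)
  open import Data.List.Properties using (unfold-reverse)
  open import Data.List.NonEmpty as List⁺ using (List⁺; _∷_; toList)
  import Data.Vec as Vec
  import Data.Vec.Properties as Vec
  open import Function using (id; _∘_)
  open import Relation.Binary.PropositionalEquality

  record BlockShift (s : ℕ) (f : ℕ → ℕ) : Set where
    field
      positive : ∀ {m} → 1 ≤ m → 1 ≤ f m
      bounded  : ∀ {i m} → 1 ≤ m → m ≤ fib (1 + i) → f m ≤ fib (1 + (s + i))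
      shift    : ∀ i → ShiftsAt s f i

  id-blockShift : BlockShift 0 id
  id-blockShift = record { positive = id ; bounded = λ _ m≤F → m≤F ; shift = λ _ _ _ → refl }

  b-blockShift : BlockShift 1 b
  b-blockShift = record
    { positive = λ {m} 1≤m → ≤-trans 1≤m (n≤b m)
    ; bounded  = λ {i} → b-block-bound {i}
    ; shift    = b-shift
    }

  d-blockShift : BlockShift 2 d
  d-blockShift = record
    { positive = λ {m} 1≤m → subst (1 ≤_) (sym (d≡n+b m)) (≤-trans 1≤m (m≤m+n m (b m)))
    ; bounded  = λ {i} {m} 1≤m m≤F → subst (_≤ fib (3 + i)) (sym (d≡n+b m))
                   (subst (m + b m ≤_) (+-comm (fib (1 + i)) _) (+-mono-≤ m≤F (b-block-bound {i} 1≤m m≤F)))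
    ; shift    = λ i → d-shift {i} (b-shift i)
    }

  ∘-blockShift : ∀ {s t f g} → BlockShift t g → BlockShift s f → BlockShift (t + s) (g ∘ f)
  ∘-blockShift {s} {t} {f} {g} G F = record
    { positive = G.positive ∘ F.positive
    ; bounded  = λ {i} {m} 1≤m m≤F → subst (λ j → g (f m) ≤ fib (1 + j)) (sym (+-assoc t s i))
                                        (G.bounded {s + i} (F.positive 1≤m) (F.bounded {i} 1≤m m≤F))
    ; shift    = shift
    }
    where
    module G = BlockShift G
    module F = BlockShift F
    shift : ∀ i → ShiftsAt (t + s) (g ∘ f) i
    shift i {m} 1≤m m≤F = begin
      g (f (block i m))               ≡⟨ cong g (F.shift i 1≤m m≤F) ⟩
      g (block (s + i) (f m))         ≡⟨ G.shift (s + i) (F.positive 1≤m) (F.bounded {i} 1≤m m≤F) ⟩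
      block (t + (s + i)) (g (f m))   ≡⟨ cong (λ j → block j (g (f m))) (sym (+-assoc t s i)) ⟩
      block (t + s + i) (g (f m))     ∎
      where open ≡-Reasoning

  weight-∷ : ∀ l ls → weight (l ∷ ls) ≡ weight (l ∷ []) + weight ls
  weight-∷ 𝕓 ls = refl
  weight-∷ 𝕕 ls = regroup (countB ls) (countD ls)
    where
    regroup : ∀ x y → x + 2 * suc y ≡ 2 + (x + 2 * y)
    regroup = solve-∀

  weight-++ : ∀ xs ys → weight (xs ++ ys) ≡ weight xs + weight ys
  weight-++ [] ys = refl
  weight-++ (x ∷ xs) ys = begin
    weight (x ∷ xs ++ ys)                      ≡⟨ weight-∷ x (xs ++ ys) ⟩
    weight (x ∷ []) + weight (xs ++ ys)        ≡⟨ cong (weight (x ∷ []) +_) (weight-++ xs ys) ⟩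
    weight (x ∷ []) + (weight xs + weight ys)  ≡⟨ sym (+-assoc (weight (x ∷ [])) _ _) ⟩
    weight (x ∷ []) + weight xs + weight ys    ≡⟨ cong (_+ weight ys) (sym (weight-∷ x xs)) ⟩
    weight (x ∷ xs) + weight ys                ∎
    where open ≡-Reasoning

  weight-reverse : ∀ xs → weight (List.reverse xs) ≡ weight xs
  weight-reverse [] = refl
  weight-reverse (x ∷ xs) = begin
    weight (List.reverse (x ∷ xs))                ≡⟨ cong weight (unfold-reverse x xs) ⟩
    weight (List.reverse xs ++ x ∷ [])            ≡⟨ weight-++ (List.reverse xs) (x ∷ []) ⟩
    weight (List.reverse xs) + weight (x ∷ [])    ≡⟨ cong (_+ weight (x ∷ [])) (weight-reverse xs) ⟩
    weight xs + weight (x ∷ [])                   ≡⟨ +-comm (weight xs) _ ⟩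
    weight (x ∷ []) + weight xs                   ≡⟨ sym (weight-∷ x xs) ⟩
    weight (x ∷ xs)                               ∎
    where open ≡-Reasoning

  weight-pos : ∀ (u : List⁺ Letter) → 1 ≤ weight (toList u)
  weight-pos (l ∷ ls) = subst (1 ≤_) (sym (weight-∷ l ls)) (≤-trans (letter l) (m≤m+n _ (weight ls)))
    where
    letter : ∀ l → 1 ≤ weight (l ∷ [])
    letter 𝕓 = s≤s z≤n
    letter 𝕕 = s≤s z≤n

  letter-blockShift : ∀ l → BlockShift (weight (l ∷ [])) (eval l)
  letter-blockShift 𝕓 = b-blockShift
  letter-blockShift 𝕕 = d-blockShift

  applyList-blockShift : ∀ ls → BlockShift (weight ls) (applyList ls)
  applyList-blockShift [] = id-blockShift
  applyList-blockShift (l ∷ ls) = subst (λ s → BlockShift s (applyList (l ∷ ls))) (sym (weight-∷ l ls))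
                                        (∘-blockShift (letter-blockShift l) (applyList-blockShift ls))

  reverse-blockShift : ∀ ls → BlockShift (weight ls) (applyList (List.reverse ls))
  reverse-blockShift ls = subst (λ s → BlockShift s (applyList (List.reverse ls))) (weight-reverse ls)
                                (applyList-blockShift (List.reverse ls))

  applyList-++ : ∀ xs ys n → applyList (xs ++ ys) n ≡ applyList xs (applyList ys n)
  applyList-++ [] ys n = refl
  applyList-++ (x ∷ xs) ys n = cong (eval x) (applyList-++ xs ys n)

  applyList-reverse-∷ : ∀ l ls n → applyList (List.reverse (l ∷ ls)) n ≡ applyList (List.reverse ls) (eval l n)
  applyList-reverse-∷ l ls n =
    trans (cong (λ xs → applyList xs n) (unfold-reverse l ls)) (applyList-++ (List.reverse ls) (l ∷ []) n)

  toList-reverse⁺ : ∀ {A : Set} (u : List⁺ A) → toList (List⁺.reverse u) ≡ List.reverse (toList u)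
  toList-reverse⁺ (y ∷ ys) = begin
    toList (List⁺.fromVec (Vec.reverse v))           ≡⟨ toList∘fromVec (Vec.reverse v) ⟩
    Vec.toList (Vec.reverse v)                       ≡⟨ Vec.toList-reverse v ⟩
    List.reverse (y ∷ Vec.toList (Vec.fromList ys))  ≡⟨ cong (List.reverse ∘ (y ∷_)) (Vec.toList∘fromList ys) ⟩
    List.reverse (y ∷ ys)                            ∎
    where
    open ≡-Reasoning
    v = y Vec.∷ Vec.fromList ys
    toList∘fromVec : ∀ {n} (w : Vec.Vec _ (suc n)) → toList (List⁺.fromVec w) ≡ Vec.toList w
    toList∘fromVec (z Vec.∷ zs) = refl


open Beatty
open Blocks
open Hofstadter
open Words
open import Data.Nat as ℕ using (ℕ; suc; _≤_; _∸_; s≤s; z≤n)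
import Data.Nat.Properties as ℕ
import Data.Nat.Tactic.RingSolver as ℕ-Solver
open import Data.Integer using (ℤ; +_; _+_; _-_; _*_)
open import Data.Integer.Properties using (pos-+; pos-*; m-n≡m⊖n; ⊖-≥)
open import Data.Integer.Tactic.RingSolver using (solve-∀)
open import Data.List as List using ([]; _∷_)
open import Data.List.Properties using (reverse-involutive)
open import Data.List.NonEmpty as List⁺ using (List⁺; _∷_; toList)
open import Data.Product using (proj₁; proj₂)
open import Function using (_∘_)
open import Relation.Binary.PropositionalEquality

pos-∸ : ∀ {m n} → n ≤ m → + (m ∸ n) ≡ + m - + n
pos-∸ {m} {n} n≤m = sym (trans (m-n≡m⊖n m n) (⊖-≥ n≤m))

a-blockℤ : ∀ {i m} → 1 ≤ m → m ≤ fib (suc i) → + a (block i m) ≡ + fib (3 ℕ.+ i) - + a m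
a-blockℤ {i} 1≤m m≤F = trans (cong +_ (a-block {i} 1≤m m≤F))
  (pos-∸ (ℕ.≤-trans (proj₂ (a-bounds 1≤m {suc i} m≤F)) (fib-mono (ℕ.m≤n+m (suc i) 2))))

a-shift : ∀ {s f i m} → BlockShift s f → 1 ≤ m → m ≤ fib (suc i) →
          + a (f (block i m)) ≡ + fib (3 ℕ.+ (s ℕ.+ i)) - + a (f m)
a-shift {s} {f} {i} F 1≤m m≤F =
  trans (cong (+_ ∘ a) (shift i 1≤m m≤F)) (a-blockℤ {s ℕ.+ i} (positive 1≤m) (bounded {i} 1≤m m≤F))
  where open BlockShift F

x-flip : ∀ {i m} → 1 ≤ m → m ≤ fib (suc i) → x (block i m) ≡ + 1 - x m
x-flip {i} {m} 1≤m m≤F = begin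
  + a (b n) - + b (a n)
    ≡⟨ cong (_- + b (a n)) (a-shift {i = i} b-blockShift 1≤m m≤F) ⟩
  (+ fib (4 ℕ.+ i) - + a (b m)) - + b (a n)
    ≡⟨ cong (λ F → (F - + a (b m)) - + b (a n)) F≡ ⟩
  ((+ b (a m) + + b (a n) + + 1) - + a (b m)) - + b (a n)
    ≡⟨ regroup (+ b (a m)) (+ b (a n)) (+ a (b m)) ⟩
  + 1 - (+ a (b m) - + b (a m)) ∎
  where
  open ≡-Reasoning
  n = block i m
  am-bounds = a-bounds 1≤m {suc i} m≤F
  am+an≡F : a m ℕ.+ a n ≡ fib (3 ℕ.+ i)
  am+an≡F = trans (cong (a m ℕ.+_) (a-block {i} 1≤m m≤F))
                  (ℕ.m+[n∸m]≡n (ℕ.≤-trans (proj₂ am-bounds) (fib-mono (ℕ.m≤n+m (suc i) 2))))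
  1≤an : 1 ≤ a n
  1≤an = proj₁ (a-bounds (ℕ.≤-trans 1≤m (ℕ.m≤n+m m _)) {3 ℕ.+ i} (ℕ.+-monoʳ-≤ (fib (2 ℕ.+ i)) m≤F))
  F≡ : + fib (4 ℕ.+ i) ≡ + b (a m) + + b (a n) + + 1
  F≡ = trans (cong +_ (sym (b-sum (2 ℕ.+ i) (proj₁ am-bounds) 1≤an am+an≡F)))
             (trans (pos-+ _ 1) (cong (_+ + 1) (pos-+ (b (a m)) (b (a n)))))
  regroup : ∀ p q r → ((p + q + + 1) - r) - q ≡ + 1 - (r - p)
  regroup = solve-∀

fib-shift-+ : ∀ v i → + fib (3 ℕ.+ (suc v ℕ.+ i)) ≡ + fib (suc v) * + fib (4 ℕ.+ i) + + fib v * + fib (3 ℕ.+ i)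
fib-shift-+ v i = begin
  + fib (3 ℕ.+ (suc v ℕ.+ i))                          ≡⟨ cong (+_ ∘ fib) (reindex v i) ⟩
  + fib (suc v ℕ.+ (3 ℕ.+ i))                          ≡⟨ cong +_ (fib-+ v (3 ℕ.+ i)) ⟩
  + (fib (suc v) ℕ.* fib (4 ℕ.+ i) ℕ.+ fib v ℕ.* fib (3 ℕ.+ i))
    ≡⟨ trans (pos-+ (fib (suc v) ℕ.* fib (4 ℕ.+ i)) _) (cong₂ _+_ (pos-* (fib (suc v)) _) (pos-* (fib v) _)) ⟩
  + fib (suc v) * + fib (4 ℕ.+ i) + + fib v * + fib (3 ℕ.+ i)  ∎
  where
  open ≡-Reasoning
  reindex : ∀ v i → 3 ℕ.+ (suc v ℕ.+ i) ≡ suc v ℕ.+ (3 ℕ.+ i)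
  reindex = ℕ-Solver.solve-∀

a-linear : ∀ {w f c} → 1 ≤ w → BlockShift w f → + a (f 1) ≡ + fib (suc w) - c → ∀ {n} → 1 ≤ n →
           + a (f n) ≡ (+ fib w * + a (b n) + + fib (w ∸ 1) * + a n) + c * (+ 2 * x n - + 1)
a-linear {suc v} {f} {c} _ F a-f1 = block-ind (λ n → + a (f n) ≡ R n) base (λ {i} → step {i})
  where
  open ≡-Reasoning
  linear : ℤ → ℤ → ℤ → ℤ
  linear A B X = (+ fib (suc v) * A + + fib v * B) + c * (+ 2 * X - + 1)
  R : ℕ → ℤ
  R n = linear (+ a (b n)) (+ a n) (x n)
  base : + a (f 1) ≡ R 1
  base = begin
    + a (f 1)                              ≡⟨ a-f1 ⟩
    + fib (suc (suc v)) - c                ≡⟨ cong (_- c) (pos-+ (fib (suc v)) (fib v)) ⟩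
    (+ fib (suc v) + + fib v) - c          ≡⟨ regroup (+ fib (suc v)) (+ fib v) c ⟩
    linear (+ 1) (+ 1) (+ 0)               ∎
    where
    regroup : ∀ p q c → (p + q) - c ≡ (p * + 1 + q * + 1) + c * (+ 2 * + 0 - + 1)
    regroup = solve-∀
  step : ∀ {i m} → 1 ≤ m → m ≤ fib (suc i) → + a (f m) ≡ R m →
         + a (f (block i m)) ≡ R (block i m)
  step {i} {m} 1≤m m≤F a-fm = begin
    + a (f (block i m))
      ≡⟨ a-shift F 1≤m m≤F ⟩
    + fib (3 ℕ.+ (suc v ℕ.+ i)) - + a (f m)
      ≡⟨ cong₂ _-_ (fib-shift-+ v i) a-fm ⟩
    (+ fib (suc v) * + fib (4 ℕ.+ i) + + fib v * + fib (3 ℕ.+ i)) - R m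
      ≡⟨ regroup (+ fib (suc v)) (+ fib v) c (+ fib (4 ℕ.+ i)) (+ fib (3 ℕ.+ i)) (+ a (b m)) (+ a m) (x m) ⟩
    linear (+ fib (4 ℕ.+ i) - + a (b m)) (+ fib (3 ℕ.+ i) - + a m) (+ 1 - x m)
      ≡⟨ cong₂ (λ A B → linear A B (+ 1 - x m)) (sym (a-shift {i = i} b-blockShift 1≤m m≤F))
                                                 (sym (a-blockℤ {i} 1≤m m≤F)) ⟩
    linear (+ a (b n)) (+ a n) (+ 1 - x m)
      ≡⟨ cong (linear (+ a (b n)) (+ a n)) (sym (x-flip {i} 1≤m m≤F)) ⟩
    R n ∎
    where
    n = block i m
    regroup : ∀ p q c P Q A B X → (p * P + q * Q) - ((p * A + q * B) + c * (+ 2 * X - + 1))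
                                  ≡ (p * (P - A) + q * (Q - B)) + c * (+ 2 * (+ 1 - X) - + 1)
    regroup = solve-∀

a-reversed-word-at-1 : ∀ l ls →
                       + a (applyList (List.reverse (l ∷ ls)) 1) ≡ + fib (suc (weight (l ∷ ls))) - Crev′ l ls
a-reversed-word-at-1 𝕓 [] = refl
a-reversed-word-at-1 𝕕 [] = refl
a-reversed-word-at-1 𝕓 (m ∷ ms) = begin
  + a (applyList (List.reverse (𝕓 ∷ m ∷ ms)) 1)      ≡⟨ cong (+_ ∘ a) (applyList-reverse-∷ 𝕓 (m ∷ ms) 1) ⟩
  + a (applyList (List.reverse (m ∷ ms)) 1)          ≡⟨ a-reversed-word-at-1 m ms ⟩
  + fib (suc w) - c                                  ≡⟨ regroup (+ fib (suc w)) (+ fib w) c ⟩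
  (+ fib (suc w) + + fib w) - (+ fib w + c)          ≡⟨ cong (_- (+ fib w + c)) (sym (pos-+ (fib (suc w)) (fib w))) ⟩
  + fib (suc (suc w)) - (+ fib w + c)                ∎
  where
  open ≡-Reasoning
  w = weight (m ∷ ms)
  c = Crev′ m ms
  regroup : ∀ p q c → p - c ≡ (p + q) - (q + c)
  regroup = solve-∀
a-reversed-word-at-1 𝕕 (m ∷ ms) = begin
  + a (applyList (List.reverse (𝕕 ∷ m ∷ ms)) 1)
    ≡⟨ cong (+_ ∘ a) (applyList-reverse-∷ 𝕕 (m ∷ ms) 1) ⟩
  + a (g (block 0 1))
    ≡⟨ a-shift {i = 0} (reverse-blockShift (m ∷ ms)) (s≤s z≤n) (s≤s z≤n) ⟩
  + fib (3 ℕ.+ (w ℕ.+ 0)) - + a (g 1)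
    ≡⟨ cong₂ _-_ (cong (λ k → + fib (3 ℕ.+ k)) (ℕ.+-identityʳ w)) (a-reversed-word-at-1 m ms) ⟩
  + fib (3 ℕ.+ w) - (+ fib (suc w) - c)
    ≡⟨ cong (λ k → + fib (suc k) - (+ fib (k ∸ 1) - c)) (sym (weight-∷ 𝕕 (m ∷ ms))) ⟩
  + fib (suc (weight (𝕕 ∷ m ∷ ms))) - (+ fib (weight (𝕕 ∷ m ∷ ms) ∸ 1) - c) ∎
  where
  open ≡-Reasoning
  w = weight (m ∷ ms)
  c = Crev′ m ms
  g = applyList (List.reverse (m ∷ ms))

a-word-at-1 : ∀ u → + a (applyWord u 1) ≡ + fib (suc (weight (toList u))) - C u
a-word-at-1 u with List⁺.reverse u | toList-reverse⁺ u
... | l ∷ ls | rev-u = begin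
  + a (applyList (toList u) 1)                       ≡⟨ cong (λ xs → + a (applyList xs 1)) u≡ ⟩
  + a (applyList (List.reverse (l ∷ ls)) 1)          ≡⟨ a-reversed-word-at-1 l ls ⟩
  + fib (suc (weight (l ∷ ls))) - Crev′ l ls         ≡⟨ cong (λ k → + fib (suc k) - Crev′ l ls) weight≡ ⟩
  + fib (suc (weight (toList u))) - Crev′ l ls       ∎
  where
  open ≡-Reasoning
  u≡ : toList u ≡ List.reverse (l ∷ ls)
  u≡ = trans (sym (reverse-involutive (toList u))) (cong List.reverse (sym rev-u))
  weight≡ : weight (l ∷ ls) ≡ weight (toList u)
  weight≡ = trans (cong weight rev-u) (weight-reverse (toList u))

theorem23 : (u : List⁺ Letter) → (n : ℕ) → 1 ≤ n →
    + a (applyWord u n)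
      ≡ (+ fib (weight (toList u)) * + a (b n)
         + + fib (weight (toList u) ∸ 1) * + a n)
        + C u * (+ 2 * x n - + 1)
theorem23 u n 1≤n = a-linear {c = C u} (weight-pos u) (applyList-blockShift (toList u)) (a-word-at-1 u) 1≤n
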